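{- Let $n,t,s$ be integers with $n/2-t$ a nonnegative integer, and let $H=(V,E)$ be a hypergraph with $|V|\le n$ whose $t$-shifted discrepancy is at least $s+t$. Then \[ \chi_F\left[K\left(n,\tfrac n2-t,s\right)\right]\le 2|E|. \]
   Context: $K(n,k,s)$ is the graph on $\binom{[n]}{k}$ in which two $k$-subsets of $[n]=\{1,\dots,n\}$ are adjacent iff they share fewer than $s$ elements. For $A\subseteq[n]$, the Frankl set is $I_A=\{v\in\binom{[n]}{k}: |v\cap A|\ge (|A|+s)/2\}$. The F-chromatic number $\chi_F[K(n,k,s)]$ is the minimum number of colors in a proper coloring in which every color class is contained in some Frankl set. For a 2-coloring (red/blue) of the vertices of a hypergraph, its $t$-shifted discrepancy is the maximum over edges $e$ of $|\mathrm{blue}(e)-\mathrm{red}(e)+t|$, where $\mathrm{blue}(e),\mathrm{red}(e)$ count blue and red vertices of $e$; the $t$-shifted discrepancy of the hypergraph is the minimum of this over all 2-colorings of its vertices. -}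

module Defs where

open import Data.Nat using (ℕ; _≤_)
open import Data.Integer as ℤ using (ℤ; +_; _-_)
open import Data.Fin using (Fin)
open import Data.Fin.Subset using (Subset; ∣_∣; _∩_; ∁)
open import Data.List using (List)
open import Data.List.Membership.Propositional using (_∈_)
open import Data.List.Relation.Unary.Unique.Propositional using (Unique)
open import Data.Product using (Σ; ∃; _×_; _,_)
open import Relation.Binary.PropositionalEquality using (_≡_; _≢_)

record KVertex (n k : ℕ) : Set where
  constructor kv
  field
    set  : Subset n
    size : ∣ set ∣ ≡ k
open KVertex public

Adjacent : {n k : ℕ} → ℤ → KVertex n k → KVertex n k → Set
Adjacent s u v = + ∣ set u ∩ set v ∣ ℤ.< s

-- v ∈ I_A iff |v ∩ A| ≥ (|A| + s)/2, i.e. 2|v ∩ A| ≥ |A| + s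
InFrankl : {n k : ℕ} → ℤ → Subset n → KVertex n k → Set
InFrankl s A v = + ∣ A ∣ ℤ.+ s ℤ.≤ + 2 ℤ.* + ∣ set v ∩ A ∣

IsFColoring : (n k : ℕ) → ℤ → (m : ℕ) → (KVertex n k → Fin m) → Set
IsFColoring n k s m c =
  (∀ u v → Adjacent s u v → c u ≢ c v) ×
  (∀ (i : Fin m) → ∃ λ (A : Subset n) → ∀ v → c v ≡ i → InFrankl s A v)

FChromatic≤ : (n k : ℕ) → ℤ → ℕ → Set
FChromatic≤ n k s M =
  Σ ℕ λ m → m ≤ M × Σ (KVertex n k → Fin m) λ c → IsFColoring n k s m c

record Hypergraph : Set where
  field
    N        : ℕ
    edges    : List (Subset N)
    distinct : Unique edges
open Hypergraph public

-- 2-coloring: blue = the subset, red = its complement.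
-- value blue(e) - red(e) + t
shifted : {N : ℕ} → ℤ → Subset N → Subset N → ℤ
shifted t blue e = + ∣ e ∩ blue ∣ - + ∣ e ∩ ∁ blue ∣ ℤ.+ t

-- t-shifted discrepancy of H is ≥ d :
-- min over colorings of max over edges of |blue(e) - red(e) + t| is ≥ d,
-- i.e. every coloring has some edge e with |blue(e) - red(e) + t| ≥ d.
ShiftedDiscAtLeast : ℤ → ℤ → Hypergraph → Set
ShiftedDiscAtLeast t d H =
  ∀ (blue : Subset (N H)) → ∃ λ e → e ∈ edges H × d ℤ.≤ + ℤ.∣ shifted t blue e ∣

-- Colour a vertex v by an edge e on which the colouring "blue = v" has shifted
-- discrepancy at least s + t, together with the sign of blue(e) - red(e) + t.
-- A nonnegative sign puts v in the Frankl set I_e, a negative one (since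
-- |v| = n/2 - t) in I_{∁e}. Every Frankl set I_A is independent in K(n,k,s),
-- because |u ∩ v| ≥ |u ∩ A| + |v ∩ A| - |A| ≥ s for u, v ∈ I_A.
-- The vertices of H are the first |V| points of [n]: v induces the colouring
-- truncate (set v), and an edge e is lifted to padRight e.
module Submission where

open import Defs
open import Data.Nat using (ℕ; _≤_; _*_; suc; z≤n; s≤s)
open import Data.Integer using (ℤ; +_; _+_; 0ℤ; _-_; -_)
open import Data.List using (List; length; lookup)

import Data.Nat as ℕ
import Data.Nat.Properties as ℕ
import Data.Integer as ℤ
import Data.Integer.Properties as ℤ
open import Data.Integer.Tactic.RingSolver using (solve-∀)
open import Data.Fin using (Fin; zero; suc; combine; remQuot)
open import Data.Fin.Properties using (remQuot-combine)
open import Data.Fin.Subset using (Subset; ∣_∣; _∩_; ∁; inside; outside)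
open import Data.Fin.Subset.Properties using (∣⊥∣≡0; ∩-zeroˡ; ∩-comm; ∣∁p∣≡n∸∣p∣; ∣p∣≤n)
open import Data.List.Membership.Propositional using (_∈_)
open import Data.List.Relation.Unary.Any using (index)
open import Data.List.Relation.Unary.Any.Properties using (lookup-index)
open import Data.Vec using (_∷_; []; truncate; padRight)
open import Data.Product using (∃; _×_; _,_; proj₁; proj₂)
open import Data.Sum using (_⊎_; inj₁; inj₂)
import Data.Sum as Sum
open import Function using (_∘_)
open import Relation.Nullary using (¬_)
open import Relation.Binary.PropositionalEquality
  using (_≡_; _≢_; refl; sym; trans; cong; subst; module ≡-Reasoning)

private
  variable
    m n k : ℕ

∣p∩q∣+∣p∩∁q∣≡∣p∣ : (p q : Subset n) → ∣ p ∩ q ∣ ℕ.+ ∣ p ∩ ∁ q ∣ ≡ ∣ p ∣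
∣p∩q∣+∣p∩∁q∣≡∣p∣ []             []            = refl
∣p∩q∣+∣p∩∁q∣≡∣p∣ (inside  ∷ p) (inside  ∷ q) = cong suc (∣p∩q∣+∣p∩∁q∣≡∣p∣ p q)
∣p∩q∣+∣p∩∁q∣≡∣p∣ (inside  ∷ p) (outside ∷ q) =
  trans (ℕ.+-suc _ _) (cong suc (∣p∩q∣+∣p∩∁q∣≡∣p∣ p q))
∣p∩q∣+∣p∩∁q∣≡∣p∣ (outside ∷ p) (_       ∷ q) = ∣p∩q∣+∣p∩∁q∣≡∣p∣ p q

∣p∣+∣∁p∣≡n : (p : Subset n) → ∣ p ∣ ℕ.+ ∣ ∁ p ∣ ≡ n
∣p∣+∣∁p∣≡n p = trans (cong (∣ p ∣ ℕ.+_) (∣∁p∣≡n∸∣p∣ p)) (ℕ.m+[n∸m]≡n (∣p∣≤n p))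

∣p∩r∣+∣q∩r∣≤∣p∩q∣+∣r∣ : (p q r : Subset n) →
                        ∣ p ∩ r ∣ ℕ.+ ∣ q ∩ r ∣ ≤ ∣ p ∩ q ∣ ℕ.+ ∣ r ∣
∣p∩r∣+∣q∩r∣≤∣p∩q∣+∣r∣ [] [] [] = z≤n
∣p∩r∣+∣q∩r∣≤∣p∩q∣+∣r∣ (inside ∷ p) (inside ∷ q) (inside ∷ r)
  rewrite ℕ.+-suc ∣ p ∩ r ∣ ∣ q ∩ r ∣ | ℕ.+-suc ∣ p ∩ q ∣ ∣ r ∣ =
  s≤s (s≤s (∣p∩r∣+∣q∩r∣≤∣p∩q∣+∣r∣ p q r))
∣p∩r∣+∣q∩r∣≤∣p∩q∣+∣r∣ (inside ∷ p) (outside ∷ q) (inside ∷ r)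
  rewrite ℕ.+-suc ∣ p ∩ q ∣ ∣ r ∣ = s≤s (∣p∩r∣+∣q∩r∣≤∣p∩q∣+∣r∣ p q r)
∣p∩r∣+∣q∩r∣≤∣p∩q∣+∣r∣ (outside ∷ p) (inside ∷ q) (inside ∷ r)
  rewrite ℕ.+-suc ∣ p ∩ r ∣ ∣ q ∩ r ∣ | ℕ.+-suc ∣ p ∩ q ∣ ∣ r ∣ =
  s≤s (∣p∩r∣+∣q∩r∣≤∣p∩q∣+∣r∣ p q r)
∣p∩r∣+∣q∩r∣≤∣p∩q∣+∣r∣ (outside ∷ p) (outside ∷ q) (inside ∷ r)
  rewrite ℕ.+-suc ∣ p ∩ q ∣ ∣ r ∣ = ℕ.m≤n⇒m≤1+n (∣p∩r∣+∣q∩r∣≤∣p∩q∣+∣r∣ p q r)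
∣p∩r∣+∣q∩r∣≤∣p∩q∣+∣r∣ (inside ∷ p) (inside ∷ q) (outside ∷ r) =
  ℕ.m≤n⇒m≤1+n (∣p∩r∣+∣q∩r∣≤∣p∩q∣+∣r∣ p q r)
∣p∩r∣+∣q∩r∣≤∣p∩q∣+∣r∣ (inside ∷ p) (outside ∷ q) (outside ∷ r) = ∣p∩r∣+∣q∩r∣≤∣p∩q∣+∣r∣ p q r
∣p∩r∣+∣q∩r∣≤∣p∩q∣+∣r∣ (outside ∷ p) (inside ∷ q) (outside ∷ r) = ∣p∩r∣+∣q∩r∣≤∣p∩q∣+∣r∣ p q r
∣p∩r∣+∣q∩r∣≤∣p∩q∣+∣r∣ (outside ∷ p) (outside ∷ q) (outside ∷ r) = ∣p∩r∣+∣q∩r∣≤∣p∩q∣+∣r∣ p q r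

∣p∩truncate∣≡∣padRight∩q∣ : (m≤n : m ≤ n) (p : Subset m) (q : Subset n) →
                             ∣ p ∩ truncate m≤n q ∣ ≡ ∣ padRight m≤n outside p ∩ q ∣
∣p∩truncate∣≡∣padRight∩q∣ {n = n} z≤n [] q = sym (trans (cong ∣_∣ (∩-zeroˡ q)) (∣⊥∣≡0 n))
∣p∩truncate∣≡∣padRight∩q∣ (s≤s m≤n) (inside  ∷ p) (inside  ∷ q) =
  cong suc (∣p∩truncate∣≡∣padRight∩q∣ m≤n p q)
∣p∩truncate∣≡∣padRight∩q∣ (s≤s m≤n) (inside  ∷ p) (outside ∷ q) =
  ∣p∩truncate∣≡∣padRight∩q∣ m≤n p q
∣p∩truncate∣≡∣padRight∩q∣ (s≤s m≤n) (outside ∷ p) (_       ∷ q) =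
  ∣p∩truncate∣≡∣padRight∩q∣ m≤n p q

∁-truncate : (m≤n : m ≤ n) (p : Subset n) → ∁ (truncate m≤n p) ≡ truncate m≤n (∁ p)
∁-truncate z≤n       p       = refl
∁-truncate (s≤s m≤n) (x ∷ p) = cong (_ ∷_) (∁-truncate m≤n p)

shifted-truncate : (m≤n : m ≤ n) (t : ℤ) (blue : Subset n) (e : Subset m) →
                   shifted t (truncate m≤n blue) e ≡ shifted t blue (padRight m≤n outside e)
shifted-truncate m≤n t blue e
  rewrite ∁-truncate m≤n blue
        | ∣p∩truncate∣≡∣padRight∩q∣ m≤n e blue
        | ∣p∩truncate∣≡∣padRight∩q∣ m≤n e (∁ blue) = refl

≤-by-difference : ∀ {i j i′ j′ : ℤ} → i - j ≡ i′ - j′ → j ℤ.≤ i → j′ ℤ.≤ i′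
≤-by-difference i-j≡i′-j′ j≤i = ℤ.0≤i-j⇒j≤i (subst (0ℤ ℤ.≤_) i-j≡i′-j′ (ℤ.i≤j⇒0≤j-i j≤i))

Frankl-intersection-bound : ∀ {a p q w s : ℤ} →
                            a + s ℤ.≤ + 2 ℤ.* p → a + s ℤ.≤ + 2 ℤ.* q → p + q ℤ.≤ w + a →
                            s ℤ.≤ w
Frankl-intersection-bound {a} {p} {q} {w} {s} h₁ h₂ h₃ =
  ℤ.*-cancelˡ-≤-pos s w (+ 2) (≤-by-difference (difference a p q w s) sum)
  where
  sum : (a + s) + (a + s) + + 2 ℤ.* (p + q) ℤ.≤ + 2 ℤ.* p + + 2 ℤ.* q + + 2 ℤ.* (w + a)
  sum = ℤ.+-mono-≤ (ℤ.+-mono-≤ h₁ h₂) (ℤ.*-monoˡ-≤-nonNeg (+ 2) h₃)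
  difference : ∀ a p q w s →
               (+ 2 ℤ.* p + + 2 ℤ.* q + + 2 ℤ.* (w + a)) - ((a + s) + (a + s) + + 2 ℤ.* (p + q))
               ≡ + 2 ℤ.* w - + 2 ℤ.* s
  difference = solve-∀

Frankl-independent : (s : ℤ) (A : Subset n) (u v : KVertex n k) →
                     InFrankl s A u → InFrankl s A v → ¬ Adjacent s u v
Frankl-independent s A u v u∈I v∈I =
  ℤ.≤⇒≯ (Frankl-intersection-bound {+ ∣ A ∣} {+ ∣ set u ∩ A ∣} {+ ∣ set v ∩ A ∣} u∈I v∈I
          (ℤ.+≤+ (∣p∩r∣+∣q∩r∣≤∣p∩q∣+∣r∣ (set u) (set v) A)))

shifted-nonneg-side : ∀ {x r t s : ℤ} → s + t ℤ.≤ x - r + t → (x + r) + s ℤ.≤ + 2 ℤ.* x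
shifted-nonneg-side {x} {r} {t} {s} = ≤-by-difference (difference x r t s)
  where
  difference : ∀ x r t s → (x - r + t) - (s + t) ≡ + 2 ℤ.* x - ((x + r) + s)
  difference = solve-∀

shifted-neg-side : ∀ {x r y a t s : ℤ} → (x + r) + a ≡ + 2 ℤ.* ((x + y) + t) →
                   s + t ℤ.≤ - (x - r + t) → a + s ℤ.≤ + 2 ℤ.* y
shifted-neg-side {x} {r} {y} {a} {t} {s} total = ≤-by-difference (begin
  - (x - r + t) - (s + t)                          ≡⟨ difference x r y a t s ⟩
  (x + r + a - two[x+y+t]) + (+ 2 ℤ.* y - (a + s)) ≡⟨ cong (λ z → z - two[x+y+t] + _) total ⟩
  (two[x+y+t] - two[x+y+t]) + (+ 2 ℤ.* y - (a + s)) ≡⟨ cong (_+ _) (ℤ.+-inverseʳ two[x+y+t]) ⟩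
  0ℤ + (+ 2 ℤ.* y - (a + s))                       ≡⟨ ℤ.+-identityˡ _ ⟩
  + 2 ℤ.* y - (a + s)                              ∎)
  where
  open ≡-Reasoning
  two[x+y+t] : ℤ
  two[x+y+t] = + 2 ℤ.* ((x + y) + t)
  difference : ∀ x r y a t s →
               - (x - r + t) - (s + t)
               ≡ (x + r + a - + 2 ℤ.* ((x + y) + t)) + (+ 2 ℤ.* y - (a + s))
  difference = solve-∀

module _ (s t : ℤ) (E : Subset n) (v : KVertex n k) where

  private
    x r y : ℕ
    x = ∣ E ∩ set v ∣
    r = ∣ E ∩ ∁ (set v) ∣
    y = ∣ set v ∩ ∁ E ∣

  InFrankl-of-shifted : s + t ℤ.≤ shifted t (set v) E → InFrankl s E v
  InFrankl-of-shifted bound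
    rewrite sym (∣p∩q∣+∣p∩∁q∣≡∣p∣ E (set v)) | ∩-comm (set v) E =
    shifted-nonneg-side {+ x} {+ r} {t} {s} bound

  InFrankl-∁-of-shifted : + n ≡ + 2 ℤ.* (+ k + t) →
                          s + t ℤ.≤ - shifted t (set v) E → InFrankl s (∁ E) v
  InFrankl-∁-of-shifted n≡2[k+t] =
    shifted-neg-side {+ x} {+ r} {+ y} {+ ∣ ∁ E ∣} {t} {s} (begin
      + (x ℕ.+ r ℕ.+ ∣ ∁ E ∣)   ≡⟨ cong (λ z → + (z ℕ.+ ∣ ∁ E ∣)) (∣p∩q∣+∣p∩∁q∣≡∣p∣ E (set v)) ⟩
      + (∣ E ∣ ℕ.+ ∣ ∁ E ∣)     ≡⟨ cong +_ (∣p∣+∣∁p∣≡n E) ⟩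
      + n                       ≡⟨ n≡2[k+t] ⟩
      + 2 ℤ.* (+ k + t)         ≡⟨ cong (λ z → + 2 ℤ.* (+ z + t)) x+y≡k ⟨
      + 2 ℤ.* (+ (x ℕ.+ y) + t) ∎)
    where
    open ≡-Reasoning
    x+y≡k : x ℕ.+ y ≡ k
    x+y≡k = begin
      x ℕ.+ y                               ≡⟨ cong (ℕ._+ y) (cong ∣_∣ (∩-comm E (set v))) ⟩
      ∣ set v ∩ E ∣ ℕ.+ ∣ set v ∩ ∁ E ∣     ≡⟨ ∣p∩q∣+∣p∩∁q∣≡∣p∣ (set v) E ⟩
      ∣ set v ∣                             ≡⟨ size v ⟩
      k                                     ∎

  InFrankl-either : + n ≡ + 2 ℤ.* (+ k + t) → s + t ℤ.≤ + ℤ.∣ shifted t (set v) E ∣ →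
                    InFrankl s E v ⊎ InFrankl s (∁ E) v
  InFrankl-either n≡2[k+t] bound = Sum.map
    (λ ∣d∣≡d → InFrankl-of-shifted (subst (s + t ℤ.≤_) ∣d∣≡d bound))
    (λ ∣d∣≡-d → InFrankl-∁-of-shifted n≡2[k+t] (subst (s + t ℤ.≤_) ∣d∣≡-d bound))
    (ℤ.+∣i∣≡i⊎+∣i∣≡-i (shifted t (set v) E))

FChromatic≤-fromCover : (s : ℤ) (A : Fin m → Subset n) →
                        (∀ (v : KVertex n k) → ∃ λ i → InFrankl s (A i) v) →
                        FChromatic≤ n k s m
FChromatic≤-fromCover {m} {n} {k} s A cover = m , ℕ.≤-refl , colour , proper , λ i → A i , classes i
  where
  colour : KVertex n k → Fin m
  colour = proj₁ ∘ cover
  classes : ∀ i v → colour v ≡ i → InFrankl s (A i) v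
  classes _ v refl = proj₂ (cover v)
  proper : ∀ u v → Adjacent s u v → colour u ≢ colour v
  proper u v u~v same =
    Frankl-independent s (A (colour v)) u v (classes _ u same) (classes _ v refl) u~v

sided : Fin 2 → Subset n → Subset n
sided zero    E = E
sided (suc _) E = ∁ E

sided-⊎ : (P : Subset n → Set) {E : Subset n} → P E ⊎ P (∁ E) → ∃ λ i → P (sided i E)
sided-⊎ P (inj₁ p) = zero , p
sided-⊎ P (inj₂ p) = suc zero , p

module _ {X : Set} (es : List X) (f : X → Subset n) where

  sidedEdge : Fin 2 × Fin (length es) → Subset n
  sidedEdge (i , l) = sided i (f (lookup es l))

  sidedFamily : Fin (2 * length es) → Subset n
  sidedFamily = sidedEdge ∘ remQuot (length es)

  sidedFamily-combine : (i : Fin 2) {x : X} (x∈es : x ∈ es) →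
                        sidedFamily (combine i (index x∈es)) ≡ sided i (f x)
  sidedFamily-combine i x∈es =
    trans (cong sidedEdge (remQuot-combine i (index x∈es)))
          (cong (sided i ∘ f) (sym (lookup-index x∈es)))

  sidedFamily-covers : (s : ℤ) (v : KVertex n k) {x : X} → x ∈ es →
                       InFrankl s (f x) v ⊎ InFrankl s (∁ (f x)) v →
                       ∃ λ j → InFrankl s (sidedFamily j) v
  sidedFamily-covers s v x∈es v∈I =
    let i , v∈sided = sided-⊎ (λ A → InFrankl s A v) v∈I in
    combine i (index x∈es) , subst (λ A → InFrankl s A v) (sym (sidedFamily-combine i x∈es)) v∈sided

lemma2 : (n k : ℕ) (t s : ℤ) →
    + n ≡ + 2 Data.Integer.* (+ k + t) →
    (H : Hypergraph) → N H ≤ n →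
    ShiftedDiscAtLeast t (s + t) H →
    FChromatic≤ n k s (2 * length (edges H))
lemma2 n k t s n≡2[k+t] H N≤n disc = FChromatic≤-fromCover s (sidedFamily (edges H) pad) cover
  where
  pad : Subset (N H) → Subset n
  pad = padRight N≤n outside
  cover : (v : KVertex n k) → ∃ λ j → InFrankl s (sidedFamily (edges H) pad j) v
  cover v =
    let e , e∈edges , bound = disc (truncate N≤n (set v)) in
    sidedFamily-covers (edges H) pad s v e∈edges
      (InFrankl-either s t (pad e) v n≡2[k+t]
        (subst (λ d → s + t ℤ.≤ + ℤ.∣ d ∣) (shifted-truncate N≤n t (set v) e) bound))
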